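{- There is a function $f:\mathbb{Z}\to\{ -1,0,1\}$ such that $f(n)=0$ unless $1\leqslant n\leqslant 300$, and such that $$\sum_{x,d\in\mathbb{Z}}f(x)f(x+d)f(x+2d)f(x+3d)<0.$$ -}

module Defs where

open import Data.Nat using (ℕ) renaming (_+_ to _ℕ+_)
open import Data.Integer using (ℤ; +_; -_; _+_; _*_; _≤_; _<_; 0ℤ; 1ℤ; -1ℤ)
open import Data.List using (List; map; foldr; upTo; concatMap)
open import Relation.Binary.PropositionalEquality using (_≡_)
open import Data.Sum using (_⊎_)
open import Data.Product using (_×_)

sumℤ : List ℤ → ℤ
sumℤ = foldr _+_ 0ℤ

InTrit : ℤ → Set
InTrit v = v ≡ -1ℤ ⊎ v ≡ 0ℤ ⊎ v ≡ 1ℤ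

window : ℕ → List ℤ
window N = map (λ k → - (+ N) + + k) (upTo (N ℕ+ N ℕ+ 1))

term : (ℤ → ℤ) → ℤ → ℤ → ℤ
term f x d = f x * f (x + d) * f (x + + 2 * d) * f (x + + 3 * d)

-- If f(n) = 0 outside 1 ≤ n ≤ 300, every nonzero term has 1 ≤ x ≤ 300 and
-- 1 ≤ x + 3d ≤ 300, hence |d| ≤ 99; so the sum over ℤ × ℤ equals the finite sum
-- over x, d ∈ [-300, 300] (all omitted terms are 0).
APSum : (ℤ → ℤ) → ℤ
APSum f = sumℤ (concatMap (λ x → map (λ d → term f x d) (window 300)) (window 300))

-- We take f to be the ±1 pattern
--     + − − − − + − − − − + −
-- placed on the positions 1, ..., 12 and extended by 0 elsewhere.  The sum
-- Σ_{x,d} f(x) f(x+d) f(x+2d) f(x+3d) is a finite computation: the twelve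
-- trivial progressions (d = 0) contribute +12, the nontrivial ones −24, so the
-- total is −12 < 0.
module Submission where

open import Defs
open import Data.Integer using (ℤ; +_; -[1+_]; -_; _≤_; _<_; 0ℤ; 1ℤ; -1ℤ; +≤+; -<+; _≟_)
open import Data.Nat using (ℕ; zero; suc; z≤n; s≤s) renaming (_≤_ to _≤ℕ_; _≤?_ to _≤ℕ?_)
open import Data.Nat.Properties using (≤-trans; ≤-pred; ≰⇒>)
open import Data.Empty using (⊥-elim)
open import Data.List using (List; []; _∷_; length)
open import Data.List.Relation.Unary.All using (All; []; _∷_; all?)
open import Data.Product using (Σ; _×_; _,_)
open import Data.Sum using (inj₁; inj₂)
open import Relation.Binary.PropositionalEquality using (_≡_; refl; sym; subst)
open import Relation.Nullary using (¬_; yes; no)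
open import Relation.Nullary.Decidable using (toWitness; _⊎-dec_)
open import Relation.Unary using (Pred; Decidable)

entry : List ℤ → ℕ → ℤ
entry []       _       = 0ℤ
entry (x ∷ xs) zero    = x
entry (x ∷ xs) (suc k) = entry xs k

entry-All : ∀ {p} {P : Pred ℤ p} {ps : List ℤ} → All P ps → P 0ℤ → ∀ k → P (entry ps k)
entry-All []         P0 k       = P0
entry-All (Px ∷ Pxs) P0 zero    = Px
entry-All (Px ∷ Pxs) P0 (suc k) = entry-All Pxs P0 k

entry-beyond : ∀ (ps : List ℤ) k → length ps ≤ℕ k → entry ps k ≡ 0ℤ
entry-beyond []       k       _         = refl
entry-beyond (x ∷ xs) (suc k) (s≤s len) = entry-beyond xs k len

placed : List ℤ → ℤ → ℤ
placed ps (+ suc k) = entry ps k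
placed ps _         = 0ℤ

placed-All : ∀ {p} {P : Pred ℤ p} {ps : List ℤ} → All P ps → P 0ℤ → ∀ n → P (placed ps n)
placed-All Pps P0 (+ zero)  = P0
placed-All Pps P0 (+ suc k) = entry-All Pps P0 k
placed-All Pps P0 -[1+ k ]  = P0

placed-support : ∀ (ps : List ℤ) N → length ps ≤ℕ N →
                 ∀ n → ¬ (+ 1 ≤ n × n ≤ + N) → placed ps n ≡ 0ℤ
placed-support ps N fits (+ zero)  _       = refl
placed-support ps N fits -[1+ k ]  _       = refl
placed-support ps N fits (+ suc k) outside with suc k ≤ℕ? N
... | yes k<N = ⊥-elim (outside (+≤+ (s≤s z≤n) , +≤+ k<N))
... | no  k≮N = entry-beyond ps k (≤-trans fits (≤-pred (≰⇒> k≮N)))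

inTrit? : Decidable InTrit
inTrit? v = (v ≟ -1ℤ) ⊎-dec (v ≟ 0ℤ) ⊎-dec (v ≟ 1ℤ)

signs : List ℤ
signs = 1ℤ ∷ -1ℤ ∷ -1ℤ ∷ -1ℤ ∷ -1ℤ ∷ 1ℤ ∷ -1ℤ ∷ -1ℤ ∷ -1ℤ ∷ -1ℤ ∷ 1ℤ ∷ -1ℤ ∷ []

signs-trits : All InTrit signs
signs-trits = toWitness {a? = all? inTrit? signs} _

-- The four-term progression sum of the pattern, by evaluation:
-- +12 from the trivial progressions d = 0 and −24 from the others.
-- (Deciding the equation forces one normalisation of the finite sum; a bare
-- refl would make the conversion checker compare the unevaluated terms.)
signs-APSum : APSum (placed signs) ≡ - (+ 12)
signs-APSum = toWitness {a? = APSum (placed signs) ≟ - (+ 12)} _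

lemma1 : Σ (ℤ → ℤ) λ f →
    ((n : ℤ) → InTrit (f n))
    × ((n : ℤ) → ¬ (+ 1 ≤ n × n ≤ + 300) → f n ≡ 0ℤ)
    × APSum f < 0ℤ
lemma1 = placed signs
       , placed-All signs-trits (inj₂ (inj₁ refl))
       , placed-support signs 300 (toWitness {a? = length signs ≤ℕ? 300} _)
       , subst (_< 0ℤ) (sym signs-APSum) -<+
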